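{- Let $G$ and $A$ be graphs such that there is no graph homomorphism from $G$ to $A$. Let $N\ge 1$ and let $\chi:[N]^2\to V(A)$ be any function. Let $\Gamma(\chi)$ be the $3$-graph on $[N]$ whose edges are the triples $1\le i<j<k\le N$ such that $\chi(i,j)\sim\chi(i,k)$, $\chi(j,i)\sim\chi(j,k)$ and $\chi(k,i)\sim\chi(k,j)$ all hold in $A$. Then $\Gamma(\chi)$ contains no copy of $L_G$.
   Context: $x\sim y$ means $x$ and $y$ are adjacent in $A$. For a graph $G$, the link hypergraph $L_G$ is the $3$-graph on $V(G)\cup\{u\}$ ($u$ a new vertex) whose edges are the triples $\{u,v,w\}$ with $\{v,w\}\in E(G)$. -}

module Defs where

open import Level using (0ℓ)
open import Data.Nat using (ℕ; suc)
open import Data.Fin using (Fin; zero; suc; _<_)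
open import Data.Product using (Σ; _×_)
open import Data.Sum using (_⊎_)
open import Relation.Nullary using (¬_)
open import Relation.Binary.PropositionalEquality using (_≡_)
open import Function.Definitions using (Injective)

record Graph : Set₁ where
  field
    n     : ℕ
    _∼_   : Fin n → Fin n → Set
    sym   : ∀ {x y} → x ∼ y → y ∼ x
    irrefl : ∀ {x} → ¬ (x ∼ x)

open Graph public

IsHom : (G A : Graph) → (Fin (n G) → Fin (n A)) → Set
IsHom G A f = ∀ {x y} → _∼_ G x y → _∼_ A (f x) (f y)

HomExists : Graph → Graph → Set
HomExists G A = Σ (Fin (n G) → Fin (n A)) (IsHom G A)

ΓEdge : (A : Graph) {N : ℕ} → (Fin N → Fin N → Fin (n A)) →
        Fin N → Fin N → Fin N → Set
ΓEdge A χ i j k =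
  (i < j) × (j < k) ×
  (_∼_ A (χ i j) (χ i k) × _∼_ A (χ j i) (χ j k) × _∼_ A (χ k i) (χ k j))

-- The unordered triple {a,b,c} is an edge of Γ(χ): some ordering of it is increasing
-- and satisfies ΓEdge.
ΓHas : (A : Graph) {N : ℕ} → (Fin N → Fin N → Fin (n A)) →
       Fin N → Fin N → Fin N → Set
ΓHas A χ a b c =
  ΓEdge A χ a b c ⊎ ΓEdge A χ a c b ⊎ ΓEdge A χ b a c ⊎
  ΓEdge A χ b c a ⊎ ΓEdge A χ c a b ⊎ ΓEdge A χ c b a

-- Link hypergraph L_G: vertex set Fin (suc (n G)), where zero is the new vertex u
-- and suc v corresponds to v ∈ V(G); edges {u, v, w} for {v,w} ∈ E(G).
ContainsLinkCopy : (G A : Graph) {N : ℕ} → (Fin N → Fin N → Fin (n A)) → Set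
ContainsLinkCopy G A {N} χ =
  Σ (Fin (suc (n G)) → Fin N) λ φ →
    Injective _≡_ _≡_ φ ×
    (∀ {v w} → _∼_ G v w → ΓHas A χ (φ zero) (φ (suc v)) (φ (suc w)))

-- Every edge {a,b,c} of Γ(χ) makes χ(a,b) ∼ χ(a,c), whichever of a, b, c is smallest.
-- So if φ embeds L_G, then v ↦ χ(φ u, φ v) is a homomorphism G → A.
module Submission where

open import Defs
open import Data.Nat using (ℕ; _≥_)
open import Data.Fin using (Fin; zero; suc)
open import Data.Product using (_,_)
open import Data.Sum using (inj₁; inj₂)
open import Function using (_∘_)
open import Relation.Nullary using (¬_)

ΓHas⇒adjacentAt : (A : Graph) {N : ℕ} (χ : Fin N → Fin N → Fin (n A)) {a b c : Fin N} →
                  ΓHas A χ a b c → _∼_ A (χ a b) (χ a c)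
ΓHas⇒adjacentAt A χ (inj₁ (_ , _ , a∼ , _ , _))                                 = a∼
ΓHas⇒adjacentAt A χ (inj₂ (inj₁ (_ , _ , a∼ , _ , _)))                          = sym A a∼
ΓHas⇒adjacentAt A χ (inj₂ (inj₂ (inj₁ (_ , _ , _ , a∼ , _))))                   = a∼
ΓHas⇒adjacentAt A χ (inj₂ (inj₂ (inj₂ (inj₁ (_ , _ , _ , _ , a∼)))))            = a∼
ΓHas⇒adjacentAt A χ (inj₂ (inj₂ (inj₂ (inj₂ (inj₁ (_ , _ , _ , a∼ , _))))))     = sym A a∼
ΓHas⇒adjacentAt A χ (inj₂ (inj₂ (inj₂ (inj₂ (inj₂ (_ , _ , _ , _ , a∼))))))     = sym A a∼

linkCopy⇒homExists : (G A : Graph) {N : ℕ} (χ : Fin N → Fin N → Fin (n A)) →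
                     ContainsLinkCopy G A χ → HomExists G A
linkCopy⇒homExists G A χ (φ , _ , edge) =
  (λ v → χ (φ zero) (φ (suc v))) , ΓHas⇒adjacentAt A χ ∘ edge

lemma2p1 : (G A : Graph) → ¬ HomExists G A →
    (N : ℕ) → N ≥ 1 → (χ : Fin N → Fin N → Fin (n A)) →
    ¬ ContainsLinkCopy G A χ
lemma2p1 G A noHom N _ χ = noHom ∘ linkCopy⇒homExists G A χ
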